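{- For every integer $\gamma\ge0$, the operad $\mathsf{DAs}_\gamma$ is isomorphic to the operad $\mathcal{S}_\gamma$ whose arity-$n$ component has basis the $\gamma$-alternating Schröder trees with $n$ leaves, and whose partial composition $\mathfrak{s}\circ_i\mathfrak{t}$ is the $\gamma$-alternating Schröder tree obtained by grafting the root of $\mathfrak{t}$ on the $i$-th leaf $x$ of $\mathfrak{s}$ and then, if the parent $y$ of $x$ and the root $z$ of $\mathfrak{t}$ have the same label, contracting the edge between $y$ and $z$. The isomorphism sends $\diamond_a$ to the tree with two leaves and one internal node labeled $a$.
   Context: All operads are nonsymmetric operads over a field $\mathbb{K}$ of characteristic zero; an operad with presentation $(G,R)$ is $\mathbf{Free}(G)/\langle R\rangle$, $\mathbf{Free}(G)$ being the free nonsymmetric operad on binary generators $G$. $[n]=\{1,\dots,n\}$. The operad $\mathsf{DAs}_\gamma$ is generated by binary elements $\diamond_a$, $a\in[\gamma]$, with space of relations spanned by $\diamond_a\circ_1\diamond_a-\diamond_a\circ_2\diamond_a$, $a\in[\gamma]$. A Schröder tree is a planar rooted tree in which every internal node has at least two children. A $\gamma$-alternating Schröder tree is a Schröder tree whose internal nodes are labeled by elements of $[\gamma]$ so that no internal node has the same label as any of its children that are internal nodes; the one-leaf tree (no internal node) is the unit of arity $1$. -}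

module Defs where

open import Level using (Level; _⊔_)
open import Data.Nat as ℕ using (ℕ; zero; suc; _+_; _∸_; _<ᵇ_)
open import Data.Fin as Fin using (Fin; toℕ)
open import Data.List using (List; []; _∷_; _++_; map; concatMap; length)
open import Data.List.Relation.Unary.All using (All)
open import Data.Product using (Σ; _×_; _,_; proj₁; proj₂; ∃-syntax)
open import Data.Unit.Polymorphic using (⊤)
open import Data.Bool using (Bool; true; false; if_then_else_)
open import Relation.Nullary using (¬_; Dec; yes; no; does)
open import Relation.Binary.PropositionalEquality using (_≡_; refl; cong; cong₂)
open import Relation.Binary.Definitions using (DecidableEquality)
open import Algebra.Bundles using (CommutativeRing)

record Field (c ℓ : Level) : Set (Level.suc (c ⊔ ℓ)) where
  field
    commutativeRing : CommutativeRing c ℓ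
  open CommutativeRing commutativeRing public
  field
    0≉1     : ¬ (0# ≈ 1#)
    inverse : ∀ x → ¬ (x ≈ 0#) → Σ Carrier (λ y → x * y ≈ 1#)

natK : ∀ {c ℓ} (K : Field c ℓ) → ℕ → Field.Carrier K
natK K zero    = Field.0# K
natK K (suc n) = Field._+_ K (Field.1# K) (natK K n)

CharZero : ∀ {c ℓ} → Field c ℓ → Set ℓ
CharZero K = ∀ n → ¬ (Field._≈_ K (natK K (suc n)) (Field.0# K))

-- Formal finite linear combinations over a set of basis symbols B.
-- Equality: same coefficient on every basis symbol.

module Lin {c ℓ} (K : Field c ℓ) where
  open Field K using (Carrier; _≈_; 0#) renaming (_+_ to _+K_; _*_ to _*K_)

  Vect : Set → Set c
  Vect B = List (Carrier × B)

  coeff : ∀ {B : Set} → DecidableEquality B → B → Vect B → Carrier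
  coeff _≟_ b [] = 0#
  coeff _≟_ b ((k , b') ∷ v) =
    if does (b ≟ b') then k +K coeff _≟_ b v else coeff _≟_ b v

  EqV : ∀ {B : Set} → DecidableEquality B → Vect B → Vect B → Set ℓ
  EqV _≟_ v w = ∀ b → coeff _≟_ b v ≈ coeff _≟_ b w

  scaleV : ∀ {B : Set} → Carrier → Vect B → Vect B
  scaleV k = map (λ p → k *K proj₁ p , proj₂ p)

  bilin : ∀ {A B C : Set} → (A → B → C) → Vect A → Vect B → Vect C
  bilin f v w = concatMap (λ p → map (λ q → proj₁ p *K proj₁ q , f (proj₂ p) (proj₂ q)) w) v

  linV : ∀ {A B : Set} → (A → B) → Vect A → Vect B
  linV f = map (λ p → proj₁ p , f (proj₂ p))

-- The free nonsymmetric operad on binary generators ◇_a, a ∈ Fin γ: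
-- basis = planar binary trees with internal nodes labelled in Fin γ.

data FTree (γ : ℕ) : Set where
  leaf : FTree γ
  node : Fin γ → FTree γ → FTree γ → FTree γ

farity : ∀ {γ} → FTree γ → ℕ
farity leaf         = 1
farity (node a l r) = farity l + farity r

-- grafting y on the i-th leaf of x (leaves indexed from 0)
fgraft : ∀ {γ} → FTree γ → ℕ → FTree γ → FTree γ
fgraft leaf i y = y
fgraft (node a l r) i y =
  if i <ᵇ farity l then node a (fgraft l i y) r
                   else node a l (fgraft r (i ∸ farity l) y)

node-inj : ∀ {γ a b} {l l' r r' : FTree γ} → node a l r ≡ node b l' r' →
           (a ≡ b) × (l ≡ l') × (r ≡ r')
node-inj refl = refl , refl , refl

_≟F_ : ∀ {γ} → DecidableEquality (FTree γ)
leaf ≟F leaf = yes refl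
leaf ≟F node _ _ _ = no λ ()
node _ _ _ ≟F leaf = no λ ()
node a l r ≟F node b l' r' with a Fin.≟ b | l ≟F l' | r ≟F r'
... | yes refl | yes refl | yes refl = yes refl
... | no ¬p | _ | _ = no λ e → ¬p (proj₁ (node-inj e))
... | yes _ | no ¬p | _ = no λ e → ¬p (proj₁ (proj₂ (node-inj e)))
... | yes _ | yes _ | no ¬p = no λ e → ¬p (proj₂ (proj₂ (node-inj e)))

-- Labelled planar trees; Schröder / γ-alternating conditions as predicates

data STree (γ : ℕ) : Set where
  leaf : STree γ
  node : Fin γ → List (STree γ) → STree γ

mutual
  sarity : ∀ {γ} → STree γ → ℕ
  sarity leaf        = 1
  sarity (node a cs) = sarityL cs

  sarityL : ∀ {γ} → List (STree γ) → ℕ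
  sarityL []       = 0
  sarityL (c ∷ cs) = sarity c + sarityL cs

NotLabel : ∀ {γ} → Fin γ → STree γ → Set
NotLabel a leaf       = ⊤
NotLabel a (node b _) = ¬ (a ≡ b)

mutual
  Alt : ∀ {γ} → STree γ → Set
  Alt leaf        = ⊤
  Alt (node a cs) = (2 ℕ.≤ length cs) × AltL a cs

  AltL : ∀ {γ} → Fin γ → List (STree γ) → Set
  AltL a []       = ⊤
  AltL a (c ∷ cs) = (Alt c × NotLabel a c) × AltL a cs

corolla : ∀ {γ} → Fin γ → STree γ
corolla a = node a (leaf ∷ leaf ∷ [])

-- put t in place of a leaf child of a node labelled a: if t is an internal
-- node with label a, the edge is contracted (its children are spliced in)
plug : ∀ {γ} → Fin γ → STree γ → List (STree γ) → List (STree γ)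
plug a leaf        rest = leaf ∷ rest
plug a (node b ds) rest =
  if does (a Fin.≟ b) then ds ++ rest else node b ds ∷ rest

mutual
  -- partial composition s ∘_i t (leaves indexed from 0)
  scomp : ∀ {γ} → STree γ → ℕ → STree γ → STree γ
  scomp leaf        i t = t
  scomp (node a cs) i t = node a (scompL a cs i t)

  scompL : ∀ {γ} → Fin γ → List (STree γ) → ℕ → STree γ → List (STree γ)
  scompL a []       i t = []
  scompL a (leaf ∷ cs) zero    t = plug a t cs
  scompL a (leaf ∷ cs) (suc i) t = leaf ∷ scompL a cs i t
  scompL a (node b ds ∷ cs) i t =
    if i <ᵇ sarityL ds then node b (scompL b ds i t) ∷ cs
                       else node b ds ∷ scompL a cs (i ∸ sarityL ds) t

mutual
  _≟S_ : ∀ {γ} → DecidableEquality (STree γ)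
  leaf ≟S leaf = yes refl
  leaf ≟S node _ _ = no λ ()
  node _ _ ≟S leaf = no λ ()
  node a cs ≟S node b ds with a Fin.≟ b | cs ≟SL ds
  ... | yes refl | yes refl = yes refl
  ... | no ¬p | _ = no λ { refl → ¬p refl }
  ... | yes _ | no ¬p = no λ { refl → ¬p refl }

  _≟SL_ : ∀ {γ} → DecidableEquality (List (STree γ))
  [] ≟SL [] = yes refl
  [] ≟SL (_ ∷ _) = no λ ()
  (_ ∷ _) ≟SL [] = no λ ()
  (c ∷ cs) ≟SL (d ∷ ds) with c ≟S d | cs ≟SL ds
  ... | yes refl | yes refl = yes refl
  ... | no ¬p | _ = no λ { refl → ¬p refl }
  ... | yes _ | no ¬p = no λ { refl → ¬p refl }

-- The unique operad morphism Free(G) → S_γ with ◇_a ↦ corolla a,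
-- on basis trees:  node a l r = (◇_a ∘₂ r) ∘₁ l.

φ : ∀ {γ} → FTree γ → STree γ
φ leaf         = leaf
φ (node a l r) = scomp (scomp (corolla a) 1 (φ r)) 0 (φ l)

-- Linear level: DAs_γ = Free(G)/⟨R⟩ and S_γ.

module Operads {c ℓ} (K : Field c ℓ) (γ : ℕ) where
  open Field K using (Carrier; 1#; -_)
  open Lin K public

  FV : Set c
  FV = Vect (FTree γ)

  SV : Set c
  SV = Vect (STree γ)

  _≈F_ : FV → FV → Set ℓ
  _≈F_ = EqV _≟F_

  _≈S_ : SV → SV → Set ℓ
  _≈S_ = EqV _≟S_

  HomF : ℕ → FV → Set c
  HomF n v = All (λ p → farity (proj₂ p) ≡ n) v

  HomS : ℕ → SV → Set c
  HomS n w = All (λ p → Alt (proj₂ p) × sarity (proj₂ p) ≡ n) w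

  compF : FV → ℕ → FV → FV
  compF v i w = bilin (λ x y → fgraft x i y) v w

  relation : Fin γ → FV
  relation a = (1# , node a (node a leaf leaf) leaf)
             ∷ (- 1# , node a leaf (node a leaf leaf)) ∷ []

  data Ideal : ℕ → FV → Set (c ⊔ ℓ) where
    gen   : (a : Fin γ) → Ideal 3 (relation a)
    nil   : ∀ {n} → Ideal n []
    add   : ∀ {n v w} → Ideal n v → Ideal n w → Ideal n (v ++ w)
    scale : ∀ {n v} (k : Carrier) → Ideal n v → Ideal n (scaleV k v)
    resp  : ∀ {n v w} → HomF n w → v ≈F w → Ideal n v → Ideal n w
    compL : ∀ {m n v} (x : FV) → HomF m x → (i : Fin m) →
            Ideal n v → Ideal (m + n ∸ 1) (compF x (toℕ i) v)
    compR : ∀ {m n v} → Ideal n v → (i : Fin n) → (x : FV) → HomF m x →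
            Ideal (n + m ∸ 1) (compF v (toℕ i) x)

  φV : FV → SV
  φV = linV φ

{-# OPTIONS --safe #-}
module Submission where

-- The morphism φ contracts every edge between two equally labelled nodes of a binary
-- tree. Contraction is local, so φ lands in alternating trees and commutes with
-- grafting, and it identifies the two sides ◇ₐ ∘₁ ◇ₐ and ◇ₐ ∘₂ ◇ₐ of each relation;
-- hence ⟨R⟩ ⊆ ker φ. Conversely, expanding every node of an alternating tree s into
-- a right comb gives a section ψ of φ, and reassociating shows t ≡ ψ (φ t) modulo ⟨R⟩
-- for every binary tree t. So every v ∈ ker φ is ≡ ψ (φ v) = 0 modulo ⟨R⟩.

open import Defs
open import Data.Nat using (ℕ)
open import Data.Fin using (Fin; toℕ)
open import Data.Fin.Properties using (toℕ<n)
open import Data.List using ([])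
open import Data.Product using (Σ; _×_; _,_)
open import Function.Bundles using (_⇔_; mk⇔)
open import Relation.Binary.PropositionalEquality using (_≡_)

module Trees where
  open import Data.Nat using (zero; suc; _+_; _∸_; _<ᵇ_; _<_; _≤_; z≤n; s≤s)
  import Data.Nat.Properties as ℕ
  import Data.Fin as Fin
  open import Data.List using (List; _∷_; _++_; length)
  open import Data.List.Properties using (++-assoc; ++-identityʳ; length-++)
  open import Data.Product using (∃₂; proj₁; proj₂)
  open import Data.Bool using (true; false)
  open import Data.Empty using (⊥-elim)
  open import Data.Unit.Polymorphic using (tt)
  open import Relation.Nullary using (¬_; yes; no)
  open import Relation.Nullary.Reflects using (ofʸ; ofⁿ)
  open import Relation.Binary.PropositionalEquality
  open ≡-Reasoning

  ∸-<-+ : ∀ {i m n} → i < m + n → ¬ i < m → i ∸ m < n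
  ∸-<-+ {i} {m} {n} i<m+n i≮m =
    subst (i ∸ m <_) (ℕ.m+n∸m≡n m n) (ℕ.∸-monoˡ-< i<m+n (ℕ.≮⇒≥ i≮m))

  module _ {γ : ℕ} where

    plug-self : ∀ (a : Fin γ) ds R → plug a (node a ds) R ≡ ds ++ R
    plug-self a ds R with a Fin.≟ a
    ... | yes _  = refl
    ... | no a≢a = ⊥-elim (a≢a refl)

    plug-NotLabel : ∀ (a : Fin γ) s R → NotLabel a s → plug a s R ≡ s ∷ R
    plug-NotLabel a leaf        R _   = refl
    plug-NotLabel a (node b ds) R a≢b with a Fin.≟ b
    ... | yes a≡b = ⊥-elim (a≢b a≡b)
    ... | no _    = refl

    plug-++ : ∀ (a : Fin γ) s X R → plug a s (X ++ R) ≡ plug a s X ++ R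
    plug-++ a leaf        X R = refl
    plug-++ a (node b ds) X R with a Fin.≟ b
    ... | yes _ = sym (++-assoc ds X R)
    ... | no _  = refl

    plug-nonempty : ∀ (a : Fin γ) s → Alt s → ∃₂ λ x xs → plug a s [] ≡ x ∷ xs
    plug-nonempty a leaf _ = leaf , [] , refl
    plug-nonempty a (node b ds) alt with a Fin.≟ b
    plug-nonempty a (node b [])       (() , _) | yes _
    plug-nonempty a (node b (d ∷ ds)) _        | yes _ = d , ds ++ [] , refl
    ... | no _ = node b ds , [] , refl

    sarityL-++ : ∀ (xs ys : List (STree γ)) → sarityL (xs ++ ys) ≡ sarityL xs + sarityL ys
    sarityL-++ []       ys = refl
    sarityL-++ (x ∷ xs) ys =
      trans (cong (sarity x +_) (sarityL-++ xs ys)) (sym (ℕ.+-assoc (sarity x) _ _))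

    sarityL-plug : ∀ (a : Fin γ) s R → sarityL (plug a s R) ≡ sarity s + sarityL R
    sarityL-plug a leaf        R = refl
    sarityL-plug a (node b ds) R with a Fin.≟ b
    ... | yes _ = sarityL-++ ds R
    ... | no _  = refl

    AltL-++ : ∀ (a : Fin γ) xs ys → AltL a xs → AltL a ys → AltL a (xs ++ ys)
    AltL-++ a []       ys _          alt-ys = alt-ys
    AltL-++ a (x ∷ xs) ys (px , pxs) alt-ys = px , AltL-++ a xs ys pxs alt-ys

    AltL-plug : ∀ (a : Fin γ) s R → Alt s → AltL a R → AltL a (plug a s R)
    AltL-plug a leaf        R _   alt-R = (tt , tt) , alt-R
    AltL-plug a (node b ds) R alt alt-R with a Fin.≟ b
    ... | yes refl = AltL-++ a ds R (proj₂ alt) alt-R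
    ... | no a≢b   = (alt , a≢b) , alt-R

    length-plug : ∀ (a : Fin γ) s R → Alt s → suc (length R) ≤ length (plug a s R)
    length-plug a leaf        R _ = ℕ.≤-refl
    length-plug a (node b ds) R alt with a Fin.≟ b
    ... | yes refl = subst (suc (length R) ≤_) (sym (length-++ ds))
                       (ℕ.+-monoˡ-≤ (length R) (ℕ.≤-trans (s≤s z≤n) (proj₁ alt)))
    ... | no _     = ℕ.≤-refl

    sarity-φ : ∀ (t : FTree γ) → sarity (φ t) ≡ farity t
    sarity-φ leaf         = refl
    sarity-φ (node a l r) = begin
      sarityL (plug a (φ l) (plug a (φ r) []))  ≡⟨ sarityL-plug a (φ l) _ ⟩
      sarity (φ l) + sarityL (plug a (φ r) [])  ≡⟨ cong (sarity (φ l) +_) (sarityL-plug a (φ r) []) ⟩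
      sarity (φ l) + (sarity (φ r) + 0)         ≡⟨ cong₂ _+_ (sarity-φ l) (trans (ℕ.+-identityʳ _) (sarity-φ r)) ⟩
      farity l + farity r                       ∎

    Alt-φ : ∀ (t : FTree γ) → Alt (φ t)
    Alt-φ leaf         = tt
    Alt-φ (node a l r) =
      ℕ.≤-trans (s≤s (length-plug a (φ r) [] (Alt-φ r))) (length-plug a (φ l) _ (Alt-φ l)) ,
      AltL-plug a (φ l) _ (Alt-φ l) (AltL-plug a (φ r) [] (Alt-φ r) tt)

    scompL-++ˡ : ∀ (a : Fin γ) ds R i t → i < sarityL ds →
                 scompL a (ds ++ R) i t ≡ scompL a ds i t ++ R
    scompL-++ˡ a []               R i       t ()
    scompL-++ˡ a (leaf ∷ ds)      R zero    t _ = plug-++ a t ds R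
    scompL-++ˡ a (leaf ∷ ds)      R (suc i) t (s≤s i<) = cong (leaf ∷_) (scompL-++ˡ a ds R i t i<)
    scompL-++ˡ a (node b es ∷ ds) R i       t i< with i <ᵇ sarityL es | ℕ.<ᵇ-reflects-< i (sarityL es)
    ... | true  | _        = refl
    ... | false | ofⁿ i≮es = cong (node b es ∷_) (scompL-++ˡ a ds R (i ∸ sarityL es) t (∸-<-+ i< i≮es))

    scompL-++ʳ : ∀ (a : Fin γ) ds R i t → sarityL ds ≤ i →
                 scompL a (ds ++ R) i t ≡ ds ++ scompL a R (i ∸ sarityL ds) t
    scompL-++ʳ a []               R i       t _ = refl
    scompL-++ʳ a (leaf ∷ ds)      R (suc i) t (s≤s ds≤i) = cong (leaf ∷_) (scompL-++ʳ a ds R i t ds≤i)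
    scompL-++ʳ a (node b es ∷ ds) R i       t es+ds≤i
      with i <ᵇ sarityL es | ℕ.<ᵇ-reflects-< i (sarityL es)
    ... | true  | ofʸ i<es = ⊥-elim (ℕ.<⇒≱ i<es (ℕ.≤-trans (ℕ.m≤m+n (sarityL es) _) es+ds≤i))
    ... | false | _        = cong (node b es ∷_) (begin
      scompL a (ds ++ R) (i ∸ sarityL es) t
        ≡⟨ scompL-++ʳ a ds R (i ∸ sarityL es) t ds≤i∸es ⟩
      ds ++ scompL a R (i ∸ sarityL es ∸ sarityL ds) t
        ≡⟨ cong (λ k → ds ++ scompL a R k t) (ℕ.∸-+-assoc i (sarityL es) (sarityL ds)) ⟩
      ds ++ scompL a R (i ∸ (sarityL es + sarityL ds)) t ∎)
      where
        ds≤i∸es : sarityL ds ≤ i ∸ sarityL es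
        ds≤i∸es = subst (_≤ i ∸ sarityL es) (ℕ.m+n∸m≡n (sarityL es) (sarityL ds))
                        (ℕ.∸-monoˡ-≤ (sarityL es) es+ds≤i)

    scompL-plug-< : ∀ (a : Fin γ) s R i t → i < sarity s →
                    scompL a (plug a s R) i t ≡ plug a (scomp s i t) R
    scompL-plug-< a leaf        R zero    t _ = refl
    scompL-plug-< a leaf        R (suc i) t (s≤s ())
    scompL-plug-< a (node b ds) R i    t i<ds with a Fin.≟ b
    ... | yes refl = scompL-++ˡ a ds R i t i<ds
    ... | no _ with i <ᵇ sarityL ds | ℕ.<ᵇ-reflects-< i (sarityL ds)
    ...   | true  | _        = refl
    ...   | false | ofⁿ i≮ds = ⊥-elim (i≮ds i<ds)

    scompL-plug-≥ : ∀ (a : Fin γ) s R i t → sarity s ≤ i →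
                    scompL a (plug a s R) i t ≡ plug a s (scompL a R (i ∸ sarity s) t)
    scompL-plug-≥ a leaf        R (suc i) t _ = refl
    scompL-plug-≥ a (node b ds) R i       t ds≤i with a Fin.≟ b
    ... | yes refl = scompL-++ʳ a ds R i t ds≤i
    ... | no _ with i <ᵇ sarityL ds | ℕ.<ᵇ-reflects-< i (sarityL ds)
    ...   | true  | ofʸ i<ds = ⊥-elim (ℕ.<⇒≱ i<ds ds≤i)
    ...   | false | _        = refl

    φ-fgraft : ∀ (x y : FTree γ) i → i < farity x → φ (fgraft x i y) ≡ scomp (φ x) i (φ y)
    φ-fgraft leaf         y zero    _ = refl
    φ-fgraft leaf         y (suc i) (s≤s ())
    φ-fgraft (node a l r) y i  i<x with i <ᵇ farity l | ℕ.<ᵇ-reflects-< i (farity l)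
    ... | true  | ofʸ i<l = cong (node a) (begin
      plug a (φ (fgraft l i y)) R
        ≡⟨ cong (λ s → plug a s R) (φ-fgraft l y i i<l) ⟩
      plug a (scomp (φ l) i (φ y)) R
        ≡⟨ scompL-plug-< a (φ l) R i (φ y) (subst (i <_) (sym (sarity-φ l)) i<l) ⟨
      scompL a (plug a (φ l) R) i (φ y) ∎)
      where
        R : List (STree γ)
        R = plug a (φ r) []
    ... | false | ofⁿ i≮l = cong (node a) (begin
      plug a (φ l) (plug a (φ (fgraft r j y)) [])
        ≡⟨ cong (λ s → plug a (φ l) (plug a s [])) (φ-fgraft r y j j<r) ⟩
      plug a (φ l) (plug a (scomp (φ r) j (φ y)) [])
        ≡⟨ cong (plug a (φ l)) (scompL-plug-< a (φ r) [] j (φ y) (subst (j <_) (sym (sarity-φ r)) j<r)) ⟨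
      plug a (φ l) (scompL a (plug a (φ r) []) j (φ y))
        ≡⟨ cong (λ k → plug a (φ l) (scompL a (plug a (φ r) []) (i ∸ k) (φ y))) (sarity-φ l) ⟨
      plug a (φ l) (scompL a (plug a (φ r) []) (i ∸ sarity (φ l)) (φ y))
        ≡⟨ scompL-plug-≥ a (φ l) _ i (φ y) (subst (_≤ i) (sym (sarity-φ l)) (ℕ.≮⇒≥ i≮l)) ⟨
      scompL a (plug a (φ l) (plug a (φ r) [])) i (φ y) ∎)
      where
        j : ℕ
        j = i ∸ farity l
        j<r : j < farity r
        j<r = ∸-<-+ i<x i≮l

    mutual
      ψ : STree γ → FTree γ
      ψ leaf        = leaf
      ψ (node a cs) = comb a cs

      comb : Fin γ → List (STree γ) → FTree γ
      comb a []           = leaf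
      comb a (x ∷ [])     = ψ x
      comb a (x ∷ y ∷ ys) = node a (ψ x) (comb a (y ∷ ys))

    mutual
      φ-ψ : ∀ (s : STree γ) → Alt s → φ (ψ s) ≡ s
      φ-ψ leaf               _          = refl
      φ-ψ (node a [])        (() , _)
      φ-ψ (node a (x ∷ []))  (s≤s () , _)
      φ-ψ (node a (x ∷ y ∷ ys)) (_ , alt) = φ-comb a x y ys alt

      φ-comb : ∀ (a : Fin γ) x y ys → AltL a (x ∷ y ∷ ys) →
               φ (comb a (x ∷ y ∷ ys)) ≡ node a (x ∷ y ∷ ys)
      φ-comb a x y [] ((alt-x , a≢x) , (alt-y , a≢y) , _) = cong (node a) (begin
        plug a (φ (ψ x)) (plug a (φ (ψ y)) [])
          ≡⟨ cong₂ (λ u v → plug a u (plug a v [])) (φ-ψ x alt-x) (φ-ψ y alt-y) ⟩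
        plug a x (plug a y [])  ≡⟨ cong (plug a x) (plug-NotLabel a y [] a≢y) ⟩
        plug a x (y ∷ [])       ≡⟨ plug-NotLabel a x _ a≢x ⟩
        x ∷ y ∷ []              ∎)
      φ-comb a x y (z ∷ zs) ((alt-x , a≢x) , alt) = cong (node a) (begin
        plug a (φ (ψ x)) (plug a (φ (comb a (y ∷ z ∷ zs))) [])
          ≡⟨ cong₂ (λ u v → plug a u (plug a v [])) (φ-ψ x alt-x) (φ-comb a y z zs alt) ⟩
        plug a x (plug a (node a (y ∷ z ∷ zs)) [])  ≡⟨ cong (plug a x) (plug-self a (y ∷ z ∷ zs) []) ⟩
        plug a x ((y ∷ z ∷ zs) ++ [])               ≡⟨ cong (plug a x) (++-identityʳ _) ⟩
        plug a x (y ∷ z ∷ zs)                       ≡⟨ plug-NotLabel a x _ a≢x ⟩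
        x ∷ y ∷ z ∷ zs                              ∎)

    farity-ψ : ∀ (s : STree γ) → Alt s → farity (ψ s) ≡ sarity s
    farity-ψ s alt = trans (sym (sarity-φ (ψ s))) (cong sarity (φ-ψ s alt))

    comb-plug-[] : ∀ (a : Fin γ) s → comb a (plug a s []) ≡ ψ s
    comb-plug-[] a leaf        = refl
    comb-plug-[] a (node b ds) with a Fin.≟ b
    ... | yes refl = cong (comb a) (++-identityʳ ds)
    ... | no _     = refl

    -- Out of range, fgraft grafts on the last leaf; the arity is the same either way.
    suc-farity-fgraft : ∀ (x : FTree γ) i y → suc (farity (fgraft x i y)) ≡ farity x + farity y
    suc-farity-fgraft leaf         i y = refl
    suc-farity-fgraft (node a l r) i y with i <ᵇ farity l
    ... | true  = begin
      suc (farity (fgraft l i y) + farity r) ≡⟨ cong (_+ farity r) (suc-farity-fgraft l i y) ⟩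
      farity l + farity y + farity r         ≡⟨ ℕ.+-assoc (farity l) _ _ ⟩
      farity l + (farity y + farity r)       ≡⟨ cong (farity l +_) (ℕ.+-comm (farity y) _) ⟩
      farity l + (farity r + farity y)       ≡⟨ ℕ.+-assoc (farity l) _ _ ⟨
      farity l + farity r + farity y         ∎
    ... | false = begin
      suc (farity l + farity (fgraft r (i ∸ farity l) y))  ≡⟨ ℕ.+-suc (farity l) _ ⟨
      farity l + suc (farity (fgraft r (i ∸ farity l) y))  ≡⟨ cong (farity l +_) (suc-farity-fgraft r _ y) ⟩
      farity l + (farity r + farity y)                     ≡⟨ ℕ.+-assoc (farity l) _ _ ⟨
      farity l + farity r + farity y                       ∎

    farity-fgraft : ∀ (x : FTree γ) i y → farity (fgraft x i y) ≡ farity x + farity y ∸ 1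
    farity-fgraft x i y = cong (_∸ 1) (suc-farity-fgraft x i y)

module LinearCombinations {c ℓ} (K : Field c ℓ) where
  open import Data.Nat using (_<_; _≤_; z≤n; s≤s)
  import Data.Nat.Properties as ℕ
  open import Data.Nat.Induction using (<-wellFounded)
  open import Induction.WellFounded using (Acc; acc)
  open import Data.List using (_∷_; _++_; map; length; concatMap)
  open import Data.List.Properties using (map-++; map-∘)
  open import Data.Product using (proj₁; proj₂)
  open import Data.Bool using (if_then_else_)
  open import Data.Empty using (⊥-elim)
  open import Relation.Nullary using (¬_; yes; no; does)
  open import Relation.Binary.Definitions using (DecidableEquality)
  import Relation.Binary.PropositionalEquality as ≡

  open Field K renaming (refl to ≈-refl; sym to ≈-sym; trans to ≈-trans)
  open Lin K
  open import Algebra.Properties.Ring ring using (-1*x≈-x; x∙y⁻¹≈ε⇒x≈y)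
  open import Algebra.Properties.CommutativeSemigroup +-commutativeSemigroup using (x∙yz≈y∙xz; interchange)
  open import Relation.Binary.Reasoning.Setoid setoid

  -k+x+[k+y]≈x+y : ∀ k x y → (- k + x) + (k + y) ≈ x + y
  -k+x+[k+y]≈x+y k x y = begin
    (- k + x) + (k + y)  ≈⟨ interchange (- k) x k y ⟩
    (- k + k) + (x + y)  ≈⟨ +-congʳ (-‿inverseˡ k) ⟩
    0# + (x + y)         ≈⟨ +-identityˡ _ ⟩
    x + y                ∎

  module _ {B : Set} (_≟_ : DecidableEquality B) where

    coeff-++ : ∀ b (v w : Vect B) → coeff _≟_ b (v ++ w) ≈ coeff _≟_ b v + coeff _≟_ b w
    coeff-++ b []            w = ≈-sym (+-identityˡ _)
    coeff-++ b ((k , x) ∷ v) w with b ≟ x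
    ... | yes _ = ≈-trans (+-congˡ (coeff-++ b v w)) (≈-sym (+-assoc k _ _))
    ... | no _  = coeff-++ b v w

    coeff-scaleV : ∀ b k (v : Vect B) → coeff _≟_ b (scaleV k v) ≈ k * coeff _≟_ b v
    coeff-scaleV b k []             = ≈-sym (zeroʳ k)
    coeff-scaleV b k ((k′ , x) ∷ v) with b ≟ x
    ... | yes _ = ≈-trans (+-congˡ (coeff-scaleV b k v)) (≈-sym (distribˡ k k′ _))
    ... | no _  = coeff-scaleV b k v

    coeff-scaleVʳ : ∀ b k (v : Vect B) →
                    coeff _≟_ b (map (λ p → proj₁ p * k , proj₂ p) v) ≈ coeff _≟_ b v * k
    coeff-scaleVʳ b k []             = ≈-sym (zeroˡ k)
    coeff-scaleVʳ b k ((k′ , x) ∷ v) with b ≟ x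
    ... | yes _ = ≈-trans (+-congˡ (coeff-scaleVʳ b k v)) (≈-sym (distribʳ k k′ _))
    ... | no _  = coeff-scaleVʳ b k v

    coeff-∷-≈0 : ∀ b {k} x (v : Vect B) → k ≈ 0# → coeff _≟_ b ((k , x) ∷ v) ≈ coeff _≟_ b v
    coeff-∷-≈0 b x v k≈0 with b ≟ x
    ... | yes _ = ≈-trans (+-congʳ k≈0) (+-identityˡ _)
    ... | no _  = ≈-refl

    ∷-cancel : ∀ {k l} x (v : Vect B) → k + l ≈ 0# → EqV _≟_ ((k , x) ∷ (l , x) ∷ v) v
    ∷-cancel {k} {l} x v k+l≈0 b with b ≟ x
    ... | yes _ = ≈-trans (≈-sym (+-assoc k l _)) (≈-trans (+-congʳ k+l≈0) (+-identityˡ _))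
    ... | no _  = ≈-refl

    ∷-cong : ∀ {k k′} x (v w : Vect B) → k ≈ k′ → EqV _≟_ v w → EqV _≟_ ((k , x) ∷ v) ((k′ , x) ∷ w)
    ∷-cong x v w k≈k′ v≈w b with b ≟ x
    ... | yes _ = +-cong k≈k′ (v≈w b)
    ... | no _  = v≈w b

    ++-zero : ∀ (v w : Vect B) → EqV _≟_ v [] → EqV _≟_ w [] → EqV _≟_ (v ++ w) []
    ++-zero v w v≈0 w≈0 b = begin
      coeff _≟_ b (v ++ w)              ≈⟨ coeff-++ b v w ⟩
      coeff _≟_ b v + coeff _≟_ b w     ≈⟨ +-cong (v≈0 b) (w≈0 b) ⟩
      0# + 0#                           ≈⟨ +-identityˡ 0# ⟩
      0#                                ∎

    scaleV-zero : ∀ k (v : Vect B) → EqV _≟_ v [] → EqV _≟_ (scaleV k v) []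
    scaleV-zero k v v≈0 b = ≈-trans (coeff-scaleV b k v) (≈-trans (*-congˡ (v≈0 b)) (zeroʳ k))

    scaleVʳ-zero : ∀ k (v : Vect B) → EqV _≟_ v [] → EqV _≟_ (map (λ p → proj₁ p * k , proj₂ p) v) []
    scaleVʳ-zero k v v≈0 b = ≈-trans (coeff-scaleVʳ b k v) (≈-trans (*-congʳ (v≈0 b)) (zeroˡ k))

    coeff-difference : ∀ b (v w : Vect B) →
                       coeff _≟_ b (v ++ scaleV (- 1#) w) ≈ coeff _≟_ b v - coeff _≟_ b w
    coeff-difference b v w = begin
      coeff _≟_ b (v ++ scaleV (- 1#) w)                  ≈⟨ coeff-++ b v _ ⟩
      coeff _≟_ b v + coeff _≟_ b (scaleV (- 1#) w)       ≈⟨ +-congˡ (coeff-scaleV b (- 1#) w) ⟩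
      coeff _≟_ b v + - 1# * coeff _≟_ b w                ≈⟨ +-congˡ (-1*x≈-x _) ⟩
      coeff _≟_ b v - coeff _≟_ b w                       ∎

    remove : B → Vect B → Vect B
    remove a []            = []
    remove a ((k , x) ∷ v) = if does (a ≟ x) then remove a v else (k , x) ∷ remove a v

    length-remove : ∀ a (v : Vect B) → length (remove a v) ≤ length v
    length-remove a []            = z≤n
    length-remove a ((k , x) ∷ v) with a ≟ x
    ... | yes _ = ℕ.m≤n⇒m≤1+n (length-remove a v)
    ... | no _  = s≤s (length-remove a v)

    length-remove-∷ : ∀ a k (v : Vect B) → length (remove a ((k , a) ∷ v)) < length ((k , a) ∷ v)
    length-remove-∷ a k v with a ≟ a
    ... | yes _  = s≤s (length-remove a v)
    ... | no a≢a = ⊥-elim (a≢a ≡.refl)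

    coeff-remove-self : ∀ a (v : Vect B) → coeff _≟_ a (remove a v) ≈ 0#
    coeff-remove-self a []            = ≈-refl
    coeff-remove-self a ((k , x) ∷ v) with a ≟ x
    ... | yes _ = coeff-remove-self a v
    ... | no a≢x with a ≟ x
    ...   | yes a≡x = ⊥-elim (a≢x a≡x)
    ...   | no _    = coeff-remove-self a v

    coeff-remove-≢ : ∀ a b (v : Vect B) → ¬ b ≡ a → coeff _≟_ b (remove a v) ≈ coeff _≟_ b v
    coeff-remove-≢ a b []            _   = ≈-refl
    coeff-remove-≢ a b ((k , x) ∷ v) b≢a with a ≟ x
    ... | yes ≡.refl with b ≟ a
    ...   | yes b≡a = ⊥-elim (b≢a b≡a)
    ...   | no _    = coeff-remove-≢ a b v b≢a
    coeff-remove-≢ a b ((k , x) ∷ v) b≢a | no _ with b ≟ x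
    ...   | yes _ = +-congˡ (coeff-remove-≢ a b v b≢a)
    ...   | no _  = coeff-remove-≢ a b v b≢a

    remove-zero : ∀ a (v : Vect B) → EqV _≟_ v [] → EqV _≟_ (remove a v) []
    remove-zero a v v≈0 b with b ≟ a
    ... | yes ≡.refl = coeff-remove-self a v
    ... | no b≢a     = ≈-trans (coeff-remove-≢ a b v b≢a) (v≈0 b)

  module _ {A B : Set} (_≟A_ : DecidableEquality A) (_≟B_ : DecidableEquality B) (g : A → B) where

    linV-remove : ∀ a (v : Vect A) →
                  EqV _≟B_ (linV g v) ((coeff _≟A_ a v , g a) ∷ linV g (remove _≟A_ a v))
    linV-remove a [] b with b ≟B g a
    ... | yes _ = ≈-sym (+-identityˡ 0#)
    ... | no _  = ≈-refl
    linV-remove a ((k , x) ∷ v) b with a ≟A x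
    ... | yes ≡.refl with b ≟B g a | linV-remove a v b
    ...   | yes _ | ih = ≈-trans (+-congˡ ih) (≈-sym (+-assoc k _ _))
    ...   | no _  | ih = ih
    linV-remove a ((k , x) ∷ v) b | no _ with b ≟B g x | b ≟B g a | linV-remove a v b
    ...   | yes _ | yes _ | ih = ≈-trans (+-congˡ ih) (x∙yz≈y∙xz k _ _)
    ...   | yes _ | no _  | ih = +-congˡ ih
    ...   | no _  | _     | ih = ih

    -- Removing every occurrence of one basis symbol from a zero vector leaves a shorter
    -- zero vector with the same image, since the removed coefficients sum to zero.
    linV-zero : ∀ (v : Vect A) → EqV _≟A_ v [] → EqV _≟B_ (linV g v) []
    linV-zero v = go v (<-wellFounded (length v))
      where
        go : ∀ (v : Vect A) → Acc _<_ (length v) → EqV _≟A_ v [] → EqV _≟B_ (linV g v) []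
        go []            _        _   b = ≈-refl
        go ((k , a) ∷ v) (acc rs) v≈0 b = begin
          coeff _≟B_ b (linV g ((k , a) ∷ v))
            ≈⟨ linV-remove a ((k , a) ∷ v) b ⟩
          coeff _≟B_ b ((coeff _≟A_ a ((k , a) ∷ v) , g a) ∷ linV g v′)
            ≈⟨ coeff-∷-≈0 _≟B_ b (g a) (linV g v′) (v≈0 a) ⟩
          coeff _≟B_ b (linV g v′)
            ≈⟨ go v′ (rs (length-remove-∷ _≟A_ a k v)) (remove-zero _≟A_ a ((k , a) ∷ v) v≈0) b ⟩
          0# ∎
          where
            v′ : Vect A
            v′ = remove _≟A_ a ((k , a) ∷ v)

    linV-scaleV : ∀ k (v : Vect A) → linV g (scaleV k v) ≡ scaleV k (linV g v)
    linV-scaleV k []      = ≡.refl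
    linV-scaleV k (p ∷ v) = ≡.cong (_ ∷_) (linV-scaleV k v)

    linV-resp : ∀ (v w : Vect A) → EqV _≟A_ v w → EqV _≟B_ (linV g v) (linV g w)
    linV-resp v w v≈w b = x∙y⁻¹≈ε⇒x≈y _ _ (begin
      coeff _≟B_ b (linV g v) - coeff _≟B_ b (linV g w)
        ≈⟨ coeff-difference _≟B_ b (linV g v) (linV g w) ⟨
      coeff _≟B_ b (linV g v ++ scaleV (- 1#) (linV g w))
        ≡⟨ ≡.cong (coeff _≟B_ b) image-of-difference ⟨
      coeff _≟B_ b (linV g (v ++ scaleV (- 1#) w))
        ≈⟨ linV-zero (v ++ scaleV (- 1#) w) difference-zero b ⟩
      0# ∎)
      where
        image-of-difference : linV g (v ++ scaleV (- 1#) w) ≡ linV g v ++ scaleV (- 1#) (linV g w)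
        image-of-difference = ≡.trans (map-++ _ v _) (≡.cong (linV g v ++_) (linV-scaleV (- 1#) w))
        difference-zero : EqV _≟A_ (v ++ scaleV (- 1#) w) []
        difference-zero a = ≈-trans (coeff-difference _≟A_ a v w)
                                    (≈-trans (+-congʳ (v≈w a)) (-‿inverseʳ _))

  module _ {A : Set} (_≟_ : DecidableEquality A) (g : A → A) where

    differences : Vect A → Vect A
    differences = concatMap (λ p → p ∷ (- proj₁ p , g (proj₂ p)) ∷ [])

    coeff-differences : ∀ a (v : Vect A) →
      coeff _≟_ a (differences v) + coeff _≟_ a (linV g v) ≈ coeff _≟_ a v
    coeff-differences a []            = +-identityˡ 0#
    coeff-differences a ((k , x) ∷ v) with a ≟ x | a ≟ g x | coeff-differences a v
    ... | yes _ | yes _ | ih = ≈-trans (+-assoc k _ _) (+-congˡ (≈-trans (-k+x+[k+y]≈x+y k _ _) ih))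
    ... | yes _ | no _  | ih = ≈-trans (+-assoc k _ _) (+-congˡ ih)
    ... | no _  | yes _ | ih = ≈-trans (-k+x+[k+y]≈x+y k _ _) ih
    ... | no _  | no _  | ih = ih

    differences-++-linV : ∀ (v : Vect A) → EqV _≟_ (differences v ++ linV g v) v
    differences-++-linV v a = ≈-trans (coeff-++ _≟_ a (differences v) (linV g v)) (coeff-differences a v)

  module _ {A B C : Set} (_≟A_ : DecidableEquality A) (_≟B_ : DecidableEquality B)
           (_≟C_ : DecidableEquality C) (f : A → B → C) where

    bilin-zeroʳ : ∀ (v : Vect A) (w : Vect B) → EqV _≟B_ w [] → EqV _≟C_ (bilin f v w) []
    bilin-zeroʳ []            w _   = λ _ → ≈-refl
    bilin-zeroʳ ((k , a) ∷ v) w w≈0 =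
      ++-zero _≟C_ (map (λ q → k * proj₁ q , f a (proj₂ q)) w) (bilin f v w)
        (≡.subst (λ u → EqV _≟C_ u []) (≡.sym (map-∘ w))
          (linV-zero _≟B_ _≟C_ (f a) (scaleV k w) (scaleV-zero _≟B_ k w w≈0)))
        (bilin-zeroʳ v w w≈0)

    coeff-bilin-∷ʳ : ∀ c (v : Vect A) k b (w : Vect B) →
      coeff _≟C_ c (bilin f v ((k , b) ∷ w))
        ≈ coeff _≟C_ c (map (λ p → proj₁ p * k , f (proj₂ p) b) v) + coeff _≟C_ c (bilin f v w)
    coeff-bilin-∷ʳ c []             k b w = ≈-sym (+-identityˡ 0#)
    coeff-bilin-∷ʳ c ((k′ , a) ∷ v) k b w = begin
      κ (corner ∷ head ++ bilin f v ((k , b) ∷ w))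
        ≈⟨ coeff-++ _≟C_ c (corner ∷ []) (head ++ bilin f v ((k , b) ∷ w)) ⟩
      κ (corner ∷ []) + κ (head ++ bilin f v ((k , b) ∷ w))
        ≈⟨ +-congˡ (coeff-++ _≟C_ c head _) ⟩
      κ (corner ∷ []) + (κ head + κ (bilin f v ((k , b) ∷ w)))
        ≈⟨ +-congˡ (+-congˡ (coeff-bilin-∷ʳ c v k b w)) ⟩
      κ (corner ∷ []) + (κ head + (κ column + κ (bilin f v w)))
        ≈⟨ +-congˡ (x∙yz≈y∙xz _ _ _) ⟩
      κ (corner ∷ []) + (κ column + (κ head + κ (bilin f v w)))
        ≈⟨ +-assoc _ _ _ ⟨
      (κ (corner ∷ []) + κ column) + (κ head + κ (bilin f v w))
        ≈⟨ +-cong (coeff-++ _≟C_ c (corner ∷ []) column) (coeff-++ _≟C_ c head _) ⟨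
      κ (corner ∷ column) + κ (head ++ bilin f v w) ∎
      where
        κ : Vect C → Carrier
        κ = coeff _≟C_ c
        corner : Carrier × C
        corner = k′ * k , f a b
        head column : Vect C
        head   = map (λ q → k′ * proj₁ q , f a (proj₂ q)) w
        column = map (λ p → proj₁ p * k , f (proj₂ p) b) v

    bilin-zeroˡ : ∀ (v : Vect A) (w : Vect B) → EqV _≟A_ v [] → EqV _≟C_ (bilin f v w) []
    bilin-zeroˡ v []            _   = nil-zero v
      where
        nil-zero : ∀ (v : Vect A) → EqV _≟C_ (bilin f v []) []
        nil-zero []      _ = ≈-refl
        nil-zero (_ ∷ v) c = nil-zero v c
    bilin-zeroˡ v ((k , b) ∷ w) v≈0 c = begin
      coeff _≟C_ c (bilin f v ((k , b) ∷ w))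
        ≈⟨ coeff-bilin-∷ʳ c v k b w ⟩
      coeff _≟C_ c (map (λ p → proj₁ p * k , f (proj₂ p) b) v) + coeff _≟C_ c (bilin f v w)
        ≈⟨ +-cong column-zero (bilin-zeroˡ v w v≈0 c) ⟩
      0# + 0#
        ≈⟨ +-identityˡ 0# ⟩
      0# ∎
      where
        column-zero : coeff _≟C_ c (map (λ p → proj₁ p * k , f (proj₂ p) b) v) ≈ 0#
        column-zero = ≡.subst (λ u → coeff _≟C_ c u ≈ 0#) (≡.sym (map-∘ v))
          (linV-zero _≟A_ _≟C_ (λ a → f a b) (map (λ p → proj₁ p * k , proj₂ p) v)
            (scaleVʳ-zero _≟A_ k v v≈0) c)

module Presentation {c ℓ} (K : Field c ℓ) (γ : ℕ) where
  open Trees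
  open LinearCombinations K
  open import Data.Nat using (_+_; _∸_; _<_; z≤n; s≤s)
  open import Data.Fin using (fromℕ<)
  open import Data.Fin.Properties using (toℕ-fromℕ<)
  open import Data.List using (_∷_; _++_; map)
  open import Data.List.Properties using (map-++; map-∘)
  open import Data.List.Relation.Unary.All using ([]; _∷_)
  open import Data.List.Relation.Unary.All.Properties using (++⁺; gmap⁺)
  open import Data.Product using (proj₁; proj₂)
  open import Function using (_∘_)
  import Relation.Binary.PropositionalEquality as ≡

  open Operads K γ
  open Field K using (_≈_; _*_; -_; 1#; -‿inverseˡ; -‿inverseʳ; -‿cong; *-identityˡ; *-identityʳ; ring)
    renaming (refl to ≈-refl; sym to ≈-sym; trans to ≈-trans; reflexive to ≈-reflexive)
  open import Algebra.Properties.Ring ring using (-‿distribʳ-*)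

  HomF-compF : ∀ {m n} (x : FV) j (v : FV) → HomF m x → HomF n v → HomF (m + n ∸ 1) (compF x j v)
  HomF-compF []            j v []          hv = []
  HomF-compF ((k , s) ∷ x) j v (hs ∷ hx) hv =
    ++⁺ (gmap⁺ (λ {q} hq → ≡.trans (farity-fgraft s j (proj₂ q)) (≡.cong₂ (λ m n → m + n ∸ 1) hs hq)) hv)
        (HomF-compF x j v hx hv)

  Ideal⇒HomF : ∀ {n v} → Ideal n v → HomF n v
  Ideal⇒HomF (gen a)           = ≡.refl ∷ ≡.refl ∷ []
  Ideal⇒HomF nil               = []
  Ideal⇒HomF (add I J)         = ++⁺ (Ideal⇒HomF I) (Ideal⇒HomF J)
  Ideal⇒HomF (scale k I)       = gmap⁺ (λ h → h) (Ideal⇒HomF I)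
  Ideal⇒HomF (resp hw _ _)     = hw
  Ideal⇒HomF (compL x hx i I)  = HomF-compF x (toℕ i) _ hx (Ideal⇒HomF I)
  Ideal⇒HomF (compR I i x hx)  = HomF-compF _ (toℕ i) x (Ideal⇒HomF I) hx

  φV-compF : ∀ {m} (v : FV) j (w : FV) → HomF m v → j < m →
             φV (compF v j w) ≡ bilin (λ s t → scomp s j t) (φV v) (φV w)
  φV-compF []            j w []        _   = ≡.refl
  φV-compF ((k , s) ∷ v) j w (hs ∷ hv) j<m =
    ≡.trans (map-++ _ (map _ w) (compF v j w)) (≡.cong₂ _++_ (row w) (φV-compF v j w hv j<m))
    where
      row : ∀ w → φV (map (λ q → k * proj₁ q , fgraft s j (proj₂ q)) w)
                ≡ map (λ q → k * proj₁ q , scomp (φ s) j (proj₂ q)) (φV w)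
      row []      = ≡.refl
      row (q ∷ w) = ≡.cong₂ _∷_ (≡.cong (_ ,_) (φ-fgraft s (proj₂ q) j (≡.subst (j <_) (≡.sym hs) j<m))) (row w)

  φ-relation : ∀ (a : Fin γ) → φ (node a (node a leaf leaf) leaf) ≡ φ (node a leaf (node a leaf leaf))
  φ-relation a = ≡.cong (node a) (≡.trans (plug-self a (leaf ∷ leaf ∷ []) (leaf ∷ []))
                                          (≡.cong (leaf ∷_) (≡.sym (plug-self a (leaf ∷ leaf ∷ []) []))))

  Ideal⊆kernel : ∀ {n v} → Ideal n v → φV v ≈S []
  Ideal⊆kernel (gen a) =
    ≡.subst (λ s → ((1# , φ (node a (node a leaf leaf) leaf)) ∷ (- 1# , s) ∷ []) ≈S [])
      (φ-relation a) (∷-cancel _≟S_ (φ (node a (node a leaf leaf) leaf)) [] (-‿inverseʳ 1#))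
  Ideal⊆kernel nil                   = λ _ → ≈-refl
  Ideal⊆kernel (add {v = v} {w} I J) =
    ≡.subst (_≈S []) (≡.sym (map-++ _ v w)) (++-zero _≟S_ (φV v) (φV w) (Ideal⊆kernel I) (Ideal⊆kernel J))
  Ideal⊆kernel (scale {v = v} k I) =
    ≡.subst (_≈S []) (≡.sym (linV-scaleV _≟F_ _≟S_ φ k v)) (scaleV-zero _≟S_ k (φV v) (Ideal⊆kernel I))
  Ideal⊆kernel (resp {v = v} {w} _ v≈w I) b =
    ≈-trans (≈-sym (linV-resp _≟F_ _≟S_ φ v w v≈w b)) (Ideal⊆kernel I b)
  Ideal⊆kernel (compL {v = v} x hx i I) =
    ≡.subst (_≈S []) (≡.sym (φV-compF x (toℕ i) v hx (toℕ<n i)))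
      (bilin-zeroʳ _≟S_ _≟S_ _≟S_ _ (φV x) (φV v) (Ideal⊆kernel I))
  Ideal⊆kernel (compR {v = v} I i x hx) =
    ≡.subst (_≈S []) (≡.sym (φV-compF v (toℕ i) x (Ideal⇒HomF I) (toℕ<n i)))
      (bilin-zeroˡ _≟S_ _≟S_ _≟S_ _ (φV v) (φV x) (Ideal⊆kernel I))

  infix 4 _∼_
  _∼_ : FTree γ → FTree γ → Set _
  t ∼ u = Ideal (farity t) ((1# , t) ∷ (- 1# , u) ∷ [])

  Ideal-pair-cong : ∀ {n k k′ l l′ t u} → k ≈ k′ → l ≈ l′ →
                    Ideal n ((k , t) ∷ (l , u) ∷ []) → Ideal n ((k′ , t) ∷ (l′ , u) ∷ [])
  Ideal-pair-cong {k = k} {k′} {l} {l′} {t} {u} k≈k′ l≈l′ I with Ideal⇒HomF I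
  ... | ht ∷ hu ∷ [] = resp (ht ∷ hu ∷ []) coefficients≈ I
    where
      coefficients≈ : ((k , t) ∷ (l , u) ∷ []) ≈F ((k′ , t) ∷ (l′ , u) ∷ [])
      coefficients≈ = ∷-cong _≟F_ t ((l , u) ∷ []) ((l′ , u) ∷ []) k≈k′ (∷-cong _≟F_ u [] [] l≈l′ (λ _ → ≈-refl))

  pair⇒∼ : ∀ {n k l t u} → Ideal n ((k , t) ∷ (l , u) ∷ []) → k ≈ 1# → l ≈ - 1# → t ∼ u
  pair⇒∼ I k≈1 l≈-1 with Ideal⇒HomF I
  ... | ≡.refl ∷ _ = Ideal-pair-cong k≈1 l≈-1 I

  ∼-refl : ∀ {t} → t ∼ t
  ∼-refl {t} = resp (≡.refl ∷ ≡.refl ∷ []) (λ b → ≈-sym (∷-cancel _≟F_ t [] (-‿inverseʳ 1#) b)) nil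

  ∼-trans : ∀ {t u w} → t ∼ u → u ∼ w → t ∼ w
  ∼-trans {t} {u} {w} t∼u u∼w with Ideal⇒HomF t∼u | Ideal⇒HomF u∼w
  ... | _ ∷ hu ∷ [] | _ ∷ hw ∷ [] =
    resp (≡.refl ∷ ≡.trans hw hu ∷ []) middle-cancels (add t∼u (≡.subst (λ n → Ideal n _) hu u∼w))
    where
      middle-cancels : ((1# , t) ∷ (- 1# , u) ∷ (1# , u) ∷ (- 1# , w) ∷ []) ≈F ((1# , t) ∷ (- 1# , w) ∷ [])
      middle-cancels = ∷-cong _≟F_ t ((- 1# , u) ∷ (1# , u) ∷ (- 1# , w) ∷ []) ((- 1# , w) ∷ []) ≈-refl
                         (∷-cancel _≟F_ u ((- 1# , w) ∷ []) (-‿inverseˡ 1#))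

  ∼-graftˡ : ∀ {t u} (x : FTree γ) j → j < farity x → t ∼ u → fgraft x j t ∼ fgraft x j u
  ∼-graftˡ {t} {u} x j j<x t∼u =
    pair⇒∼ (≡.subst (λ i → Ideal _ (compF ((1# , x) ∷ []) i ((1# , t) ∷ (- 1# , u) ∷ [])))
                     (toℕ-fromℕ< j<x) (compL ((1# , x) ∷ []) (≡.refl ∷ []) (fromℕ< j<x) t∼u))
           (*-identityʳ 1#) (*-identityˡ (- 1#))

  ∼-graftʳ : ∀ {t u} j → j < farity t → (y : FTree γ) → t ∼ u → fgraft t j y ∼ fgraft u j y
  ∼-graftʳ {t} {u} j j<t y t∼u =
    pair⇒∼ (≡.subst (λ i → Ideal _ (compF ((1# , t) ∷ (- 1# , u) ∷ []) i ((1# , y) ∷ [])))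
                     (toℕ-fromℕ< j<t) (compR t∼u (fromℕ< j<t) ((1# , y) ∷ []) (≡.refl ∷ [])))
           (*-identityʳ 1#) (*-identityʳ (- 1#))

  ∼-nodeˡ : ∀ a {l l′} r → l ∼ l′ → node a l r ∼ node a l′ r
  ∼-nodeˡ a r = ∼-graftˡ (node a leaf r) 0 (s≤s z≤n)

  -- Grafting into node a l leaf would use the leaf index farity l, on which fgraft does
  -- not compute; grafting into node a leaf leaf keeps every index a literal.
  ∼-nodeʳ : ∀ a l {r r′} → r ∼ r′ → node a l r ∼ node a l r′
  ∼-nodeʳ a l r∼r′ = ∼-graftʳ 0 (s≤s z≤n) l (∼-graftˡ (node a leaf leaf) 1 (s≤s (s≤s z≤n)) r∼r′)

  ∼-assoc : ∀ a x y z → node a (node a x y) z ∼ node a x (node a y z)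
  ∼-assoc a x y z =
    ∼-graftʳ 0 (s≤s z≤n) x (∼-graftʳ 1 (s≤s (s≤s z≤n)) y (∼-graftʳ 2 (s≤s (s≤s (s≤s z≤n))) z (gen a)))

  ∼-comb-++ : ∀ a x xs y ys → node a (comb a (x ∷ xs)) (comb a (y ∷ ys)) ∼ comb a ((x ∷ xs) ++ (y ∷ ys))
  ∼-comb-++ a x []        y ys = ∼-refl
  ∼-comb-++ a x (x′ ∷ xs) y ys =
    ∼-trans (∼-assoc a (ψ x) (comb a (x′ ∷ xs)) (comb a (y ∷ ys)))
            (∼-nodeʳ a (ψ x) (∼-comb-++ a x′ xs y ys))

  ∼-ψ-plug : ∀ a l r → Alt l → Alt r → node a (ψ l) (ψ r) ∼ comb a (plug a l (plug a r []))
  ∼-ψ-plug a l r alt-l alt-r with plug-nonempty a l alt-l | plug-nonempty a r alt-r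
  ... | x , xs , l≡ | y , ys , r≡ =
    ≡.subst₂ _∼_ (≡.cong₂ (node a) (comb-pieces l l≡) (comb-pieces r r≡)) (≡.cong (comb a) (≡.sym plug≡))
      (∼-comb-++ a x xs y ys)
    where
      comb-pieces : ∀ s {z zs} → plug a s [] ≡ z ∷ zs → comb a (z ∷ zs) ≡ ψ s
      comb-pieces s s≡ = ≡.trans (≡.cong (comb a) (≡.sym s≡)) (comb-plug-[] a s)
      plug≡ : plug a l (plug a r []) ≡ (x ∷ xs) ++ (y ∷ ys)
      plug≡ = ≡.trans (≡.cong (plug a l) r≡) (≡.trans (plug-++ a l [] (y ∷ ys)) (≡.cong (_++ (y ∷ ys)) l≡))

  ∼-ψφ : ∀ t → t ∼ ψ (φ t)
  ∼-ψφ leaf         = ∼-refl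
  ∼-ψφ (node a l r) =
    ∼-trans (∼-nodeˡ a r (∼-ψφ l))
      (∼-trans (∼-nodeʳ a (ψ (φ l)) (∼-ψφ r)) (∼-ψ-plug a (φ l) (φ r) (Alt-φ l) (Alt-φ r)))

  differences-ψφ-∈-Ideal : ∀ {n} (v : FV) → HomF n v → Ideal n (differences _≟F_ (ψ ∘ φ) v)
  differences-ψφ-∈-Ideal []            []         = nil
  differences-ψφ-∈-Ideal ((k , t) ∷ v) (≡.refl ∷ hv) =
    add (Ideal-pair-cong (*-identityʳ k) (≈-trans (≈-sym (-‿distribʳ-* k 1#)) (-‿cong (*-identityʳ k)))
                         (scale k (∼-ψφ t)))
        (differences-ψφ-∈-Ideal v hv)

  kernel⊆Ideal : ∀ {n} (v : FV) → HomF n v → φV v ≈S [] → Ideal n v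
  kernel⊆Ideal v hv φv≈0 =
    resp hv (differences-++-linV _≟F_ (ψ ∘ φ) v)
      (add (differences-ψφ-∈-Ideal v hv)
           (resp (gmap⁺ (λ {p} → ≡.trans (farity-ψφ (proj₂ p))) hv) (λ b → ≈-sym (ψφv≈0 b)) nil))
    where
      farity-ψφ : ∀ t → farity (ψ (φ t)) ≡ farity t
      farity-ψφ t = ≡.trans (farity-ψ (φ t) (Alt-φ t)) (sarity-φ t)
      ψφv≈0 : linV (ψ ∘ φ) v ≈F []
      ψφv≈0 = ≡.subst (_≈F []) (≡.sym (map-∘ v)) (linV-zero _≟S_ _≟F_ ψ (φV v) φv≈0)

  φV-surjective : ∀ n (w : SV) → HomS n w → Σ FV (λ v → HomF n v × (φV v ≈S w))
  φV-surjective n w hw =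
    linV ψ w ,
    gmap⁺ (λ (alt , s≡n) → ≡.trans (farity-ψ _ alt) s≡n) hw ,
    λ b → ≈-reflexive (≡.cong (coeff _≟S_ b) (φV-ψV w hw))
    where
      φV-ψV : ∀ w → HomS n w → φV (linV ψ w) ≡ w
      φV-ψV []            []               = ≡.refl
      φV-ψV ((k , s) ∷ w) ((alt , _) ∷ hw) = ≡.cong₂ _∷_ (≡.cong (k ,_) (φ-ψ s alt)) (φV-ψV w hw)

open Trees using (Alt-φ; sarity-φ; φ-fgraft)
open Presentation using (φV-surjective; kernel⊆Ideal; Ideal⊆kernel)

proposition3p1p5 : ∀ {c ℓ} (K : Field c ℓ) → CharZero K → (γ : ℕ) →
  let open Operads K γ in
    -- φ maps arity-n basis trees to γ-alternating Schröder trees with n leaves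
    (∀ (t : FTree γ) → Alt (φ t) × sarity (φ t) ≡ farity t)
    -- φ is an operad morphism (compatible with partial compositions)
  × (∀ (x y : FTree γ) (i : Fin (farity x)) →
       φ (fgraft x (toℕ i) y) ≡ scomp (φ x) (toℕ i) (φ y))
    -- φ is surjective onto each component of S_γ
  × (∀ n (w : SV) → HomS n w → Σ FV (λ v → HomF n v × (φV v ≈S w)))
    -- the kernel of φ is exactly the ideal ⟨R⟩, so Free(G)/⟨R⟩ ≅ S_γ
  × (∀ n (v : FV) → HomF n v → ((φV v ≈S []) ⇔ Ideal n v))
proposition3p1p5 K _ γ =
  (λ t → Alt-φ t , sarity-φ t) ,
  (λ x y i → φ-fgraft x y (toℕ i) (toℕ<n i)) ,
  φV-surjective K γ ,
  (λ n v hv → mk⇔ (kernel⊆Ideal K γ v hv) (Ideal⊆kernel K γ))
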